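{- Let $T\subset V$ satisfy $w(T)>W_L$ and $|T|\le F_L$, put $r=w(T)-W_L$, let $i\in T$, and let \[ \mathcal{F}=\Big\{x\in\mathcal{P}:\ w_i+\sum_{j\in T\setminus\{i\}} w_jx_{ij}+\sum_{j\in V\setminus T}(w_j+r)x_{ij}= w(T)\Big\} \] be the face of $\mathcal{P}$ defined by the $(T,i)$-Weight-Lowerbound inequality $w_i+\sum_{j\in T\setminus\{i\}} w_jx_{ij}+\sum_{j\in V\setminus T}(w_j+r)x_{ij}\ge w(T)$. If $\mathcal{F}\neq\emptyset$, then $|T|\ge F_L-1$.
   Context: Let $n,k$ be integers with $k\ge 2$, $F_L:=\lfloor n/k\rfloor\ge 2$ and $F_U:=\lceil n/k\rceil$. Let $G=(V,E)$ be the complete graph on $V=\{1,\dots,n\}$, let $w:V\to\mathbb{R}^+$ be node weights and $W_L\le W_U$ positive reals. For $x\in\{0,1\}^E$ write $x_{ij}=x_{ji}$ for the coordinate of edge $\{i,j\}$. Let $r_0=n \bmod k$ and $\beta_{n,k}=r_0F_U(F_U-1)/2+(k-r_0)F_L(F_L-1)/2$. $\mathcal{P}$ is the convex hull of all $x\in\{0,1\}^E$ satisfying: for all distinct $i<j<l$, $x_{ij}+x_{jl}-x_{il}\le1$, $x_{ij}-x_{jl}+x_{il}\le1$, $-x_{ij}+x_{jl}+x_{il}\le1$; for all $i\in V$, $F_L\le 1+\sum_{j\ne i}x_{ij}\le F_U$ and $W_L\le w_i+\sum_{j\ne i}w_jx_{ij}\le W_U$; and $\sum_{\{i,j\}\in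 E}x_{ij}=\beta_{n,k}$. For $T\subseteq V$, $w(T)=\sum_{i\in T}w_i$. Under the stated hypotheses the $(T,i)$-Weight-Lowerbound inequality is valid for $\mathcal{P}$. -}

module Defs where

open import Data.Nat as ℕ using (ℕ; NonZero; _/_; _%_; _∸_)
open import Data.Integer as ℤ using (ℤ)
open import Data.Bool using (Bool; true; false; if_then_else_)
open import Data.Fin using (Fin; toℕ; zero; suc)
open import Data.Fin.Subset using (Subset; _∈_; ∣_∣)
open import Data.Fin.Subset.Properties using (_∈?_)
open import Data.Product using (Σ; ∃; _×_; _,_)
open import Relation.Binary.PropositionalEquality using (_≡_; _≢_)
open import Relation.Nullary using (does; ¬_)
open import Algebra.Structures using (IsCommutativeRing)
open import Data.Sum using (_⊎_)
open import Data.Fin using (_≟_)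

-- Scalars: a linearly ordered field (ℝ is the intended model).

record OrderedField : Set₁ where
  infixl 6 _+_
  infixl 7 _*_
  infix  4 _≤_
  field
    Carrier : Set
    _+_ _*_ : Carrier → Carrier → Carrier
    -_      : Carrier → Carrier
    0# 1#   : Carrier
    isCommutativeRing : IsCommutativeRing _≡_ _+_ _*_ -_ 0# 1#
    0≢1     : 0# ≢ 1#
    inverse : ∀ x → x ≢ 0# → ∃ λ y → x * y ≡ 1#
    _≤_     : Carrier → Carrier → Set
    ≤-refl    : ∀ {x} → x ≤ x
    ≤-trans   : ∀ {x y z} → x ≤ y → y ≤ z → x ≤ z
    ≤-antisym : ∀ {x y} → x ≤ y → y ≤ x → x ≡ y
    ≤-total   : ∀ x y → (x ≤ y) ⊎ (y ≤ x)
    +-mono-≤  : ∀ {x y} z → x ≤ y → x + z ≤ y + z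
    *-nonneg  : ∀ {x y} → 0# ≤ x → 0# ≤ y → 0# ≤ x * y

  infix 4 _<_
  _<_ : Carrier → Carrier → Set
  x < y = x ≤ y × x ≢ y

  Σ[_] : ∀ {m} → (Fin m → Carrier) → Carrier
  Σ[_] {ℕ.zero}  f = 0#
  Σ[_] {ℕ.suc m} f = f zero + Σ[_] (λ j → f (suc j))

  ⟦_⟧ : Bool → Carrier
  ⟦ b ⟧ = if b then 1# else 0#

  wt : ∀ {n} → (Fin n → Carrier) → Subset n → Carrier
  wt w T = Σ[ (λ j → if does (j ∈? T) then w j else 0#) ]



sumℕ : ∀ {m} → (Fin m → ℕ) → ℕ
sumℕ {ℕ.zero}  f = 0
sumℕ {ℕ.suc m} f = f zero ℕ.+ sumℕ (λ j → f (suc j))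

bit : Bool → ℕ
bit true  = 1
bit false = 0

bitℤ : Bool → ℤ
bitℤ b = ℤ.+ (bit b)

FL : (n k : ℕ) → .{{NonZero k}} → ℕ
FL n k = n / k

FU : (n k : ℕ) → .{{NonZero k}} → ℕ
FU n k with n % k
... | ℕ.zero  = n / k
... | ℕ.suc _ = ℕ.suc (n / k)

β : (n k : ℕ) → .{{NonZero k}} → ℕ
β n k = (r₀ ℕ.* ((FU n k ℕ.* (FU n k ∸ 1)) / 2))
        ℕ.+ ((k ∸ r₀) ℕ.* ((FL n k ℕ.* (FL n k ∸ 1)) / 2))
  where r₀ = n % k

-- Points of {0,1}^E for the complete graph on Fin n.
-- A 0/1 edge vector is a symmetric Bool-valued function on pairs;
-- only off-diagonal entries i ≢ j are coordinates (diagonal ignored).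

module _ (K : OrderedField) where
  open OrderedField K

  record BinPoint (n : ℕ) : Set where
    field
      edge : Fin n → Fin n → Bool
      sym  : ∀ i j → edge i j ≡ edge j i
  open BinPoint public

  degree : ∀ {n} → BinPoint n → Fin n → ℕ
  degree y i = sumℕ (λ j → if does (j ≟ i) then 0 else bit (edge y i j))

  clusterWeight : ∀ {n} → (Fin n → Carrier) → BinPoint n → Fin n → Carrier
  clusterWeight w y i =
    w i + Σ[ (λ j → if does (j ≟ i) then 0# else w j * ⟦ edge y i j ⟧) ]

  edgeCount : ∀ {n} → BinPoint n → ℕ
  edgeCount y = sumℕ (λ i → sumℕ (λ j →
    if does (ℕ.suc (toℕ i) ℕ.≤? toℕ j) then bit (edge y i j) else 0))

  record Feasible (n k : ℕ) .{{_ : NonZero k}}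
                  (w : Fin n → Carrier) (WL WU : Carrier)
                  (y : BinPoint n) : Set where
    field
      triangle : ∀ (i j l : Fin n) → toℕ i ℕ.< toℕ j → toℕ j ℕ.< toℕ l →
        let xij = bitℤ (edge y i j)
            xjl = bitℤ (edge y j l)
            xil = bitℤ (edge y i l)
        in ((xij ℤ.+ xjl ℤ.- xil) ℤ.≤ ℤ.+ 1)
         × ((xij ℤ.- xjl ℤ.+ xil) ℤ.≤ ℤ.+ 1)
         × ((ℤ.- xij ℤ.+ xjl ℤ.+ xil) ℤ.≤ ℤ.+ 1)
      sizeLower   : ∀ i → FL n k ℕ.≤ 1 ℕ.+ degree y i
      sizeUpper   : ∀ i → 1 ℕ.+ degree y i ℕ.≤ FU n k
      weightLower : ∀ i → WL ≤ clusterWeight w y i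
      weightUpper : ∀ i → clusterWeight w y i ≤ WU
      edgeTotal   : edgeCount y ≡ β n k

  -- x ∈ 𝒫 = conv{ feasible 0/1 points }: x is a finite convex combination
  -- of feasible 0/1 points (coordinates x i j for i ≢ j).
  InP : (n k : ℕ) .{{_ : NonZero k}} (w : Fin n → Carrier) (WL WU : Carrier)
        (x : Fin n → Fin n → Carrier) → Set
  InP n k w WL WU x =
    Σ ℕ λ m → Σ (Fin m → Carrier) λ λs → Σ (Fin m → BinPoint n) λ ys →
        (∀ t → Feasible n k w WL WU (ys t))
      × (∀ t → 0# ≤ λs t)
      × (Σ[ λs ] ≡ 1#)
      × (∀ i j → i ≢ j → x i j ≡ Σ[ (λ t → λs t * ⟦ edge (ys t) i j ⟧) ])

  wlbLHS : ∀ {n} → (Fin n → Carrier) → Subset n → Carrier → Fin n →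
           (Fin n → Fin n → Carrier) → Carrier
  wlbLHS w T r i x =
    w i + Σ[ (λ j → if does (j ≟ i) then 0#
                    else if does (j ∈? T) then w j * x i j
                    else (w j + r) * x i j) ]

-- Put W = w(T) and r = W - WL > 0.  For a 0/1 point y of 𝒫 the left-hand
-- side of the inequality splits as
--     lhs(y) = clusterWeight(y,i) + r · out(y),
-- where out(y) is the number of neighbours of i outside T.  The cluster of i
-- (i and its neighbours) is covered by T and those outside neighbours, so
-- F_L ≤ 1 + deg(i) ≤ |T| + out(y).  If |T| < F_L - 1 this forces out(y) ≥ 2,
-- hence lhs(y) ≥ WL + 2r = W + r.  The left-hand side is affine in the row
-- x_{i·}, so it is the convex average of its values at the 0/1 points
-- representing x ∈ 𝒫; therefore lhs(x) ≥ W + r > W and x is not on the face.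
module Submission where

open import Defs
open import Data.Nat as ℕ using (ℕ; NonZero; _∸_)
open import Data.Fin using (Fin)
open import Data.Fin.Subset using (Subset; _∈_; ∣_∣)
open import Data.Product using (Σ; _×_)
open import Relation.Binary.PropositionalEquality using (_≡_)

open import Data.Nat.Properties as ℕP using ()
open import Data.Fin using (zero; suc; _≟_)
open import Data.Fin.Subset using (inside; outside)
open import Data.Fin.Subset.Properties using (_∈?_)
open import Data.Bool using (Bool; true; false; if_then_else_)
open import Data.Vec using ([]; _∷_)
open import Data.Product using (_,_)
open import Data.Empty using (⊥-elim)
open import Relation.Nullary using (does; yes; no)
open import Relation.Binary.PropositionalEquality
  using (refl; trans; cong; cong₂; subst; subst₂; _≢_; module ≡-Reasoning)
  renaming (sym to ≡-sym)
open import Algebra.Bundles using (CommutativeRing)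
open import Algebra.Structures using (IsCommutativeRing)

module NatSums where
  open import Algebra.Properties.CommutativeMonoid.Sum ℕP.+-0-commutativeMonoid
    using (sum; ∑-distrib-+)

  sumℕ≡sum : ∀ {m} (f : Fin m → ℕ) → sumℕ f ≡ sum f
  sumℕ≡sum {ℕ.zero}  f = refl
  sumℕ≡sum {ℕ.suc m} f = cong (f zero ℕ.+_) (sumℕ≡sum (λ j → f (suc j)))

  sumℕ-+ : ∀ {m} (f g : Fin m → ℕ) →
    sumℕ (λ j → f j ℕ.+ g j) ≡ sumℕ f ℕ.+ sumℕ g
  sumℕ-+ f g = trans (sumℕ≡sum (λ j → f j ℕ.+ g j)) (trans (∑-distrib-+ f g)
    (≡-sym (cong₂ ℕ._+_ (sumℕ≡sum f) (sumℕ≡sum g))))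

  sumℕ-mono : ∀ {m} {f g : Fin m → ℕ} → (∀ j → f j ℕ.≤ g j) → sumℕ f ℕ.≤ sumℕ g
  sumℕ-mono {ℕ.zero}  le = ℕ.z≤n
  sumℕ-mono {ℕ.suc m} le = ℕP.+-mono-≤ (le zero) (sumℕ-mono (λ j → le (suc j)))

  sumℕ-zero : ∀ {m} → sumℕ (λ (_ : Fin m) → 0) ≡ 0
  sumℕ-zero {ℕ.zero}  = refl
  sumℕ-zero {ℕ.suc m} = sumℕ-zero {m}

  sumℕ-indicator : ∀ {m} (i : Fin m) → sumℕ (λ j → if does (j ≟ i) then 1 else 0) ≡ 1
  sumℕ-indicator {ℕ.suc m} zero = cong ℕ.suc (sumℕ-zero {m})
  sumℕ-indicator (suc i)        = sumℕ-indicator i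

  sumℕ-card : ∀ {m} (T : Subset m) → sumℕ (λ j → bit (does (j ∈? T))) ≡ ∣ T ∣
  sumℕ-card []            = refl
  sumℕ-card (inside ∷ T)  = cong ℕ.suc (sumℕ-card T)
  sumℕ-card (outside ∷ T) = sumℕ-card T

open NatSums

module OrderedFieldFacts (K : OrderedField) where
  open OrderedField K
  open IsCommutativeRing isCommutativeRing
    using (+-assoc; +-comm; +-identityˡ; +-identityʳ; -‿inverseˡ; -‿inverseʳ;
           *-comm; *-identityˡ; *-identityʳ; zeroʳ; distribˡ)

  ring : CommutativeRing _ _
  ring = record { isCommutativeRing = isCommutativeRing }

  open import Algebra.Properties.Semiring.Sum (CommutativeRing.semiring ring)
    using (sum; sum-cong-≗; ∑-distrib-+; ∑-comm; *-distribˡ-sum)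
  open import Algebra.Definitions.RawMonoid (CommutativeRing.+-rawMonoid ring)
    public using () renaming (_×_ to _·ℕ_)

  Σ≡sum : ∀ {m} (f : Fin m → Carrier) → Σ[ f ] ≡ sum f
  Σ≡sum {ℕ.zero}  f = refl
  Σ≡sum {ℕ.suc m} f = cong (f zero +_) (Σ≡sum (λ j → f (suc j)))

  Σ-cong : ∀ {m} {f g : Fin m → Carrier} → (∀ j → f j ≡ g j) → Σ[ f ] ≡ Σ[ g ]
  Σ-cong {f = f} {g} e = trans (Σ≡sum f) (trans (sum-cong-≗ e) (≡-sym (Σ≡sum g)))

  Σ-+ : ∀ {m} (f g : Fin m → Carrier) → Σ[ (λ j → f j + g j) ] ≡ Σ[ f ] + Σ[ g ]
  Σ-+ f g = trans (Σ≡sum (λ j → f j + g j)) (trans (∑-distrib-+ f g)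
    (≡-sym (cong₂ _+_ (Σ≡sum f) (Σ≡sum g))))

  Σ-comm : ∀ {m p} (F : Fin m → Fin p → Carrier) →
    Σ[ (λ t → Σ[ F t ]) ] ≡ Σ[ (λ j → Σ[ (λ t → F t j) ]) ]
  Σ-comm F = begin
    Σ[ (λ t → Σ[ F t ]) ]                 ≡⟨ Σ-cong (λ t → Σ≡sum (F t)) ⟩
    Σ[ (λ t → sum (F t)) ]                ≡⟨ Σ≡sum (λ t → sum (F t)) ⟩
    sum (λ t → sum (F t))                 ≡⟨ ∑-comm F ⟩
    sum (λ j → sum (λ t → F t j))         ≡⟨ ≡-sym (Σ≡sum (λ j → sum (λ t → F t j))) ⟩
    Σ[ (λ j → sum (λ t → F t j)) ]        ≡⟨ Σ-cong (λ j → ≡-sym (Σ≡sum (λ t → F t j))) ⟩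
    Σ[ (λ j → Σ[ (λ t → F t j) ]) ]       ∎
    where open ≡-Reasoning

  Σ-*ˡ : ∀ {m} c (f : Fin m → Carrier) → Σ[ (λ j → c * f j) ] ≡ c * Σ[ f ]
  Σ-*ˡ c f = trans (Σ≡sum (λ j → c * f j))
    (trans (≡-sym (*-distribˡ-sum c f)) (cong (c *_) (≡-sym (Σ≡sum f))))

  Σ-*ʳ : ∀ {m} c (f : Fin m → Carrier) → Σ[ (λ j → f j * c) ] ≡ Σ[ f ] * c
  Σ-*ʳ c f = trans (Σ-cong (λ j → *-comm (f j) c)) (trans (Σ-*ˡ c f) (*-comm c _))

  Σ-count : ∀ {m} r (c : Fin m → Bool) →
    Σ[ (λ j → r * ⟦ c j ⟧) ] ≡ sumℕ (λ j → bit (c j)) ·ℕ r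
  Σ-count {ℕ.zero}  r c = refl
  Σ-count {ℕ.suc m} r c with c zero
  ... | true  = cong₂ _+_ (*-identityʳ r) (Σ-count r (λ j → c (suc j)))
  ... | false = trans (cong₂ _+_ (zeroʳ r) (Σ-count r (λ j → c (suc j)))) (+-identityˡ _)

  ≤-add : ∀ {a b c d} → a ≤ b → c ≤ d → a + c ≤ b + d
  ≤-add {a} {b} {c} {d} p q =
    ≤-trans (+-mono-≤ c p) (subst₂ _≤_ (+-comm c b) (+-comm d b) (+-mono-≤ b q))

  ≤-cancelˡ : ∀ {a b c} → a + b ≤ a + c → b ≤ c
  ≤-cancelˡ {a} {b} {c} p = subst₂ _≤_ (drop b) (drop c) (+-mono-≤ (- a) p)
    where
    drop : ∀ x → a + x + (- a) ≡ x
    drop x = trans (cong (_+ (- a)) (+-comm a x)) (trans (+-assoc x a (- a))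
               (trans (cong (x +_) (-‿inverseʳ a)) (+-identityʳ x)))

  sub-nonneg : ∀ {a b} → a ≤ b → 0# ≤ b + (- a)
  sub-nonneg {a} {b} p = subst (_≤ b + (- a)) (-‿inverseʳ a) (+-mono-≤ (- a) p)

  sub-+ : ∀ a b → a + (b + (- a)) ≡ b
  sub-+ a b = trans (+-comm a _) (trans (+-assoc b (- a) a)
                (trans (cong (b +_) (-‿inverseˡ a)) (+-identityʳ b)))

  *-monoˡ-≤ : ∀ {l a b} → 0# ≤ l → a ≤ b → l * a ≤ l * b
  *-monoˡ-≤ {l} {a} {b} 0≤l a≤b =
    subst₂ _≤_ (+-identityˡ (l * a)) l[b-a]+la
      (+-mono-≤ (l * a) (*-nonneg 0≤l (sub-nonneg a≤b)))
    where
    l[b-a]+la : l * (b + (- a)) + l * a ≡ l * b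
    l[b-a]+la = trans (≡-sym (distribˡ l _ a)) (cong (l *_) (trans (+-comm _ a) (sub-+ a b)))

  Σ-mono : ∀ {m} {f g : Fin m → Carrier} → (∀ j → f j ≤ g j) → Σ[ f ] ≤ Σ[ g ]
  Σ-mono {ℕ.zero}  e = ≤-refl
  Σ-mono {ℕ.suc m} e = ≤-add (e zero) (Σ-mono (λ j → e (suc j)))

  average-lower-bound : ∀ {m} {c} (λs f : Fin m → Carrier) →
    (∀ t → 0# ≤ λs t) → Σ[ λs ] ≡ 1# → (∀ t → c ≤ f t) →
    c ≤ Σ[ (λ t → λs t * f t) ]
  average-lower-bound {c = c} λs f λs≥0 Σλs≡1 c≤f =
    subst (_≤ Σ[ (λ t → λs t * f t) ]) Σλsc≡c
      (Σ-mono (λ t → *-monoˡ-≤ (λs≥0 t) (c≤f t)))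
    where
    Σλsc≡c : Σ[ (λ t → λs t * c) ] ≡ c
    Σλsc≡c = trans (Σ-*ʳ c λs) (trans (cong (_* c) Σλs≡1) (*-identityˡ c))

  two≤·ℕ : ∀ {r} m → 0# ≤ r → 2 ℕ.≤ m → r + r ≤ m ·ℕ r
  two≤·ℕ {r} (ℕ.suc (ℕ.suc m)) 0≤r (ℕ.s≤s (ℕ.s≤s _)) =
    ≤-add ≤-refl (subst (_≤ r + m ·ℕ r) (+-identityʳ r) (≤-add ≤-refl (nonneg m)))
    where
    nonneg : ∀ m → 0# ≤ m ·ℕ r
    nonneg ℕ.zero    = ≤-refl
    nonneg (ℕ.suc m) = subst (_≤ r + m ·ℕ r) (+-identityˡ 0#) (≤-add 0≤r (nonneg m))

module WeightLowerbound (K : OrderedField) {n} (w : Fin n → OrderedField.Carrier K)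
                        (T : Subset n) (r : OrderedField.Carrier K) (i : Fin n) where
  open OrderedField K
  open OrderedFieldFacts K
  open IsCommutativeRing isCommutativeRing
    using (+-assoc; +-identityˡ; +-identityʳ; *-assoc; *-comm; *-identityˡ; zeroʳ; distribˡ; distribʳ)

  outsideNbr : BinPoint K n → Fin n → Bool
  outsideNbr y j = if does (j ≟ i) then false else if does (j ∈? T) then false else edge y i j

  outCount : BinPoint K n → ℕ
  outCount y = sumℕ (λ j → bit (outsideNbr y j))

  -- The cluster of i ∈ T (i with its neighbours) lies in T ∪ {outside
  -- neighbours}, so its size 1 + deg(i) is at most |T| + out(y).
  cluster-covered : ∀ y → i ∈ T → 1 ℕ.+ degree K y i ℕ.≤ outCount y ℕ.+ ∣ T ∣
  cluster-covered y i∈T = begin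
    1 ℕ.+ degree K y i                ≡⟨ cong (ℕ._+ degree K y i) (≡-sym (sumℕ-indicator i)) ⟩
    sumℕ isI ℕ.+ degree K y i         ≡⟨ ℕP.+-comm (sumℕ isI) _ ⟩
    degree K y i ℕ.+ sumℕ isI         ≡⟨ ≡-sym (sumℕ-+ _ isI) ⟩
    sumℕ (λ j → nbr j ℕ.+ isI j)      ≤⟨ sumℕ-mono pointwise ⟩
    sumℕ (λ j → bit (outsideNbr y j) ℕ.+ bit (does (j ∈? T)))
                                      ≡⟨ sumℕ-+ (λ j → bit (outsideNbr y j)) (λ j → bit (does (j ∈? T))) ⟩
    outCount y ℕ.+ sumℕ (λ j → bit (does (j ∈? T)))
                                      ≡⟨ cong (outCount y ℕ.+_) (sumℕ-card T) ⟩
    outCount y ℕ.+ ∣ T ∣              ∎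
    where
    open ℕP.≤-Reasoning
    nbr isI : Fin n → ℕ
    nbr j = if does (j ≟ i) then 0 else bit (edge y i j)
    isI j = if does (j ≟ i) then 1 else 0

    pointwise : ∀ j → nbr j ℕ.+ isI j ℕ.≤ bit (outsideNbr y j) ℕ.+ bit (does (j ∈? T))
    pointwise j with j ≟ i
    ... | yes refl with i ∈? T
    ...   | yes _   = ℕP.≤-refl
    ...   | no i∉T  = ⊥-elim (i∉T i∈T)
    pointwise j | no _ with does (j ∈? T) | edge y i j
    ...   | true  | true  = ℕP.≤-refl
    ...   | true  | false = ℕ.z≤n
    ...   | false | _     = ℕP.≤-refl

  term : (Fin n → Fin n → Carrier) → Fin n → Carrier
  term x j = if does (j ≟ i) then 0#
             else if does (j ∈? T) then w j * x i j
             else (w j + r) * x i j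

  coords : BinPoint K n → Fin n → Fin n → Carrier
  coords y a b = ⟦ edge y a b ⟧

  lhs : BinPoint K n → Carrier
  lhs y = wlbLHS K w T r i (coords y)

  lhs-split : ∀ y → lhs y ≡ clusterWeight K w y i + outCount y ·ℕ r
  lhs-split y = begin
    w i + Σ[ term (coords y) ]
      ≡⟨ cong (w i +_) (trans (Σ-cong split) (Σ-+ clusterTerm outsideTerm)) ⟩
    w i + (Σ[ clusterTerm ] + Σ[ outsideTerm ])
      ≡⟨ ≡-sym (+-assoc (w i) _ _) ⟩
    clusterWeight K w y i + Σ[ outsideTerm ]
      ≡⟨ cong (clusterWeight K w y i +_) (Σ-count r (outsideNbr y)) ⟩
    clusterWeight K w y i + outCount y ·ℕ r ∎
    where
    open ≡-Reasoning
    clusterTerm outsideTerm : Fin n → Carrier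
    clusterTerm j = if does (j ≟ i) then 0# else w j * ⟦ edge y i j ⟧
    outsideTerm j = r * ⟦ outsideNbr y j ⟧

    split : ∀ j → term (coords y) j ≡ clusterTerm j + outsideTerm j
    split j with does (j ≟ i) | does (j ∈? T)
    ... | true  | _     = ≡-sym (trans (cong (0# +_) (zeroʳ r)) (+-identityˡ 0#))
    ... | false | true  = ≡-sym (trans (cong (w j * ⟦ edge y i j ⟧ +_) (zeroʳ r)) (+-identityʳ _))
    ... | false | false = distribʳ _ (w j) r

  -- The left-hand side depends affinely on the row x_{i·} (off the diagonal),
  -- so at a convex combination of 0/1 points it is the same combination.
  lhs-average : ∀ {m} (λs : Fin m → Carrier) (ys : Fin m → BinPoint K n)
    (x : Fin n → Fin n → Carrier) → Σ[ λs ] ≡ 1# →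
    (∀ a b → a ≢ b → x a b ≡ Σ[ (λ t → λs t * ⟦ edge (ys t) a b ⟧) ]) →
    Σ[ (λ t → λs t * lhs (ys t)) ] ≡ wlbLHS K w T r i x
  lhs-average {m} λs ys x Σλs≡1 x≡Σ = begin
    Σ[ (λ t → λs t * (w i + Σ[ term (y t) ])) ]
      ≡⟨ Σ-cong (λ t → distribˡ (λs t) (w i) _) ⟩
    Σ[ (λ t → λs t * w i + λs t * Σ[ term (y t) ]) ]
      ≡⟨ Σ-+ (λ t → λs t * w i) (λ t → λs t * Σ[ term (y t) ]) ⟩
    Σ[ (λ t → λs t * w i) ] + Σ[ (λ t → λs t * Σ[ term (y t) ]) ]
      ≡⟨ cong₂ _+_ Σλs·wi≡wi (Σ-cong (λ t → ≡-sym (Σ-*ˡ (λs t) (term (y t))))) ⟩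
    w i + Σ[ (λ t → Σ[ (λ j → λs t * term (y t) j) ]) ]
      ≡⟨ cong (w i +_) (Σ-comm (λ t j → λs t * term (y t) j)) ⟩
    w i + Σ[ (λ j → Σ[ (λ t → λs t * term (y t) j) ]) ]
      ≡⟨ cong (w i +_) (Σ-cong coordinate) ⟩
    w i + Σ[ term x ] ∎
    where
    open ≡-Reasoning
    y : Fin m → Fin n → Fin n → Carrier
    y t = coords (ys t)

    Σλs·wi≡wi : Σ[ (λ t → λs t * w i) ] ≡ w i
    Σλs·wi≡wi = trans (Σ-*ʳ (w i) λs) (trans (cong (_* w i) Σλs≡1) (*-identityˡ (w i)))

    weighted : ∀ j a → j ≢ i → Σ[ (λ t → λs t * (a * y t i j)) ] ≡ a * x i j
    weighted j a j≢i =
      trans (Σ-cong (λ t → trans (≡-sym (*-assoc (λs t) a _))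
              (trans (cong (_* _) (*-comm (λs t) a)) (*-assoc a (λs t) _))))
            (trans (Σ-*ˡ a (λ t → λs t * y t i j))
                   (cong (a *_) (≡-sym (x≡Σ i j (λ i≡j → j≢i (≡-sym i≡j))))))

    coordinate : ∀ j → Σ[ (λ t → λs t * term (y t) j) ] ≡ term x j
    coordinate j with j ≟ i
    ... | yes _ = trans (Σ-*ʳ 0# λs) (zeroʳ _)
    ... | no j≢i with does (j ∈? T)
    ...   | true  = weighted j (w j) j≢i
    ...   | false = weighted j (w j + r) j≢i

  lhs-lower-bound : ∀ {k} .{{_ : NonZero k}} {WL WU} → i ∈ T → 0# ≤ r →
    ∣ T ∣ ℕ.+ 2 ℕ.≤ FL n k → ∀ x → InP K n k w WL WU x →
    WL + (r + r) ≤ wlbLHS K w T r i x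
  lhs-lower-bound {k} {WL = WL} i∈T 0≤r short x
                  (_ , λs , ys , feasible , λs≥0 , Σλs≡1 , x≡Σ) =
    subst (WL + (r + r) ≤_) (lhs-average λs ys x Σλs≡1 x≡Σ)
      (average-lower-bound λs (λ t → lhs (ys t)) λs≥0 Σλs≡1 vertexBound)
    where
    twoOutside : ∀ t → 2 ℕ.≤ outCount (ys t)
    twoOutside t = ℕP.+-cancelʳ-≤ ∣ T ∣ 2 _ (begin
      2 ℕ.+ ∣ T ∣              ≡⟨ ℕP.+-comm 2 ∣ T ∣ ⟩
      ∣ T ∣ ℕ.+ 2              ≤⟨ short ⟩
      FL n k                   ≤⟨ Feasible.sizeLower (feasible t) i ⟩
      1 ℕ.+ degree K (ys t) i  ≤⟨ cluster-covered (ys t) i∈T ⟩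
      outCount (ys t) ℕ.+ ∣ T ∣ ∎)
      where open ℕP.≤-Reasoning

    vertexBound : ∀ t → WL + (r + r) ≤ lhs (ys t)
    vertexBound t = subst (WL + (r + r) ≤_) (≡-sym (lhs-split (ys t)))
      (≤-add (Feasible.weightLower (feasible t) i) (two≤·ℕ _ 0≤r (twoOutside t)))

proposition5 : (n k : ℕ) .{{_ : NonZero k}} → 2 ℕ.≤ k → 2 ℕ.≤ FL n k →
    (K : OrderedField) →
    let open OrderedField K in
    (w : Fin n → Carrier) → (∀ j → 0# < w j) →
    (WL WU : Carrier) → 0# < WL → WL ≤ WU →
    (T : Subset n) → WL < wt w T → ∣ T ∣ ℕ.≤ FL n k →
    (i : Fin n) → i ∈ T →
    Σ (Fin n → Fin n → Carrier) (λ x →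
        InP K n k w WL WU x × (wlbLHS K w T (wt w T + (- WL)) i x ≡ wt w T)) →
    FL n k ∸ 1 ℕ.≤ ∣ T ∣
proposition5 n k _ FL≥2 K w _ WL WU _ _ T (WL≤W , WL≢W) _ i i∈T (x , x∈P , onFace)
  with FL n k ∸ 1 ℕP.≤? ∣ T ∣
... | yes FL-1≤|T| = FL-1≤|T|
... | no  FL-1≰|T| = ⊥-elim (WL≢W WL≡W)
  where
  open OrderedField K
  open OrderedFieldFacts K
  open IsCommutativeRing isCommutativeRing using (+-identityʳ)
  W = wt w T
  r = W + (- WL)

  WL+r≡W : WL + r ≡ W
  WL+r≡W = sub-+ WL W

  short : ∣ T ∣ ℕ.+ 2 ℕ.≤ FL n k
  short = subst (ℕ._≤ FL n k) (≡-sym (ℕP.+-suc ∣ T ∣ 1))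
    (ℕP.m≤o∸n⇒m+n≤o (ℕ.suc ∣ T ∣) (ℕP.≤-trans (ℕ.s≤s ℕ.z≤n) FL≥2) (ℕP.≰⇒> FL-1≰|T|))

  -- On the face, WL + 2r ≤ lhs(x) = W = WL + r, so r ≤ 0.
  r≤0 : r ≤ 0#
  r≤0 = ≤-cancelˡ (subst (r + r ≤_) (≡-sym (+-identityʳ r)) (≤-cancelˡ WL+2r≤WL+r))
    where
    WL+2r≤WL+r : WL + (r + r) ≤ WL + r
    WL+2r≤WL+r = subst (WL + (r + r) ≤_) (trans onFace (≡-sym WL+r≡W))
      (WeightLowerbound.lhs-lower-bound K w T r i i∈T (sub-nonneg WL≤W) short x x∈P)

  WL≡W : WL ≡ W
  WL≡W = begin
    WL       ≡⟨ ≡-sym (+-identityʳ WL) ⟩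
    WL + 0#  ≡⟨ cong (WL +_) (≤-antisym (sub-nonneg WL≤W) r≤0) ⟩
    WL + r   ≡⟨ WL+r≡W ⟩
    W        ∎
    where open ≡-Reasoning
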